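{- (i) For all contexts $\Gamma,\Gamma'$, variables $x,y$, types $T, T', T_1$ and terms $t, t_1, t_2, t'$: if $\Gamma, x{:}T, \Gamma' \vdash t_1\,t_2 : T'$, $\Gamma \vdash t : T$, $[t/x]^T\, t_1 = \lambda y{:}T_1.\,t'$, and $t_1$ is not a $\lambda$-abstraction, then $t_1$ is in head normal form and there exists a type $A$ such that $\mathsf{ctype}_T(x, t_1) = A$. (ii) For all contexts $\Gamma,\Gamma'$, variables $x,y$, types $T, T', T''$ and terms $t, t_1, t_2, t'$: if $\Gamma, x{:}T, \Gamma' \vdash t_1\,t_2 : T'$, $\Gamma \vdash t : T$, $[t/x]^T\, t_1 = \Delta y{:}\neg(T''\to T').\,t'$, and $t_1$ is not a $\Delta$-abstraction, then there exists a type $A$ such that $\mathsf{ctype}_T(x, t_1) = A$.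
   Context: The $\lambda\Delta$-calculus. Types: $T ::= \perp \mid b \mid A \to B$ ($b$ base types, $\perp$ absurdity); $\neg A$ abbreviates $A \to \perp$. Terms: $t ::= x \mid \lambda x{:}T.\,t \mid \Delta x{:}T.\,t \mid t_1\, t_2$ ($\lambda,\Delta$ bind $x$; bound variables are always renamed to avoid capture). A term is in head normal form (in the sense used here) if it has the form $x\,s_1\cdots s_k$ ($k\ge 0$), i.e. its head is a variable, where $\mathsf{head}(x)=x$ and $\mathsf{head}(t_1\,t_2)=\mathsf{head}(t_1)$. Contexts $\Gamma$: finite lists of $x{:}A$ with distinct variables. Typing: (Ax) $x{:}T\in\Gamma \Rightarrow \Gamma\vdash x:T$; (Lam) $\Gamma,x{:}A\vdash t:B \Rightarrow \Gamma\vdash \lambda x{:}A.\,t : A\to B$; (App) $\Gamma\vdash t_1:A\to B$, $\Gamma\vdash t_2:A \Rightarrow \Gamma\vdash t_1\,t_2 : B$; (Delta) $\Gamma,x{:}\neg A\vdash t:\perp \Rightarrow \Gamma\vdash \Delta x{:}\neg A.\,t : A$. Type ordering: $>$ is the strict subexpression ordering on types (compatible closure of $A\to B > A$ and $A\to B > B$). Partial function $\mathsf{ctype}$: $\mathsf{ctype}_T(x,x) = T$; $\mathsf{ctype}_T(x, t_1\,t_2) = T''$ if $\mathsf{ctype}_T(x,t_1) = T'\to T''$; undefined otherwise. Multi-substitutions $\Theta ::= \cdot \mid \Theta, (y,z,t)$. Hereditary substitution $[t/x]^A t'$ and hereditary structural substitution $\langle\Theta\rangle^{A_1}_{A_2}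 t'$ are partial functions defined by mutual recursion on $(A, f, t')$ ordered lexicographically (type ordering, $f\in\{0,1\}$ with $f=0$ for $[\cdot/\cdot]$ and $f=1$ for $\langle\cdot\rangle$, strict subterm ordering), by these clauses (fresh variables chosen as needed): (S1) $\langle\Theta\rangle^{A_1}_{A_2} x = \lambda y{:}A_1\to A_2.\,(z\,(y\,t))$ if $(x,z,t)\in\Theta$, $y$ fresh; (S2) $\langle\Theta\rangle^{A_1}_{A_2} x = x$ if no $(x,z,t)\in\Theta$; (S3) $\langle\Theta\rangle^{A_1}_{A_2}(\lambda y{:}A.\,t) = \lambda y{:}A.\,\langle\Theta\rangle^{A_1}_{A_2}t$; (S4) $\langle\Theta\rangle^{A_1}_{A_2}(\Delta y{:}A.\,t) = \Delta y{:}A.\,\langle\Theta\rangle^{A_1}_{A_2}t$; (S5) $\langle\Theta\rangle^{A_1}_{A_2}(x\,t') = z\,([t/y]^{A_1} s)$ if $(x,z,t)\in\Theta$, $t' \equiv \lambda y{:}A_1.\,t''$ and $\langle\Theta\rangle^{A_1}_{A_2} t'' = s$; (S6) $\langle\Theta\rangle^{A_1}_{A_2}(x\,t') = z\,(\Delta z_2{:}\neg A_2.\,s)$ if $(x,z,t)\in\Theta$, $t'\equiv \Delta y{:}\neg(A_1\to A_2).\,t''$, and $\langle\Theta,(y,z_2,t)\rangle^{A_1}_{A_2} t'' = s$, $z_2$ fresh; (S7) $\langle\Theta\rangle^{A_1}_{A_2}(x\,t') = z\,s'$ if $(x,z,t)\in\Theta$, $t'$ is not an abstraction and $\langle\Theta\rangle^{A_1}_{A_2}t'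 = s'$; (S8) $\langle\Theta\rangle^{A_1}_{A_2}(t_1\,t_2) = s_1\,s_2$ if $t_1$ is not a variable occurring as a first component in $\Theta$, and $\langle\Theta\rangle^{A_1}_{A_2}t_i = s_i$. (H1) $[t/x]^A x = t$, $[t/x]^A y = y$ for $y\neq x$; (H2) $[t/x]^A(\lambda y{:}A'.\,t') = \lambda y{:}A'.\,[t/x]^A t'$ and $[t/x]^A(\Delta y{:}A'.\,t') = \Delta y{:}A'.\,[t/x]^A t'$; (H3) $[t/x]^A(t_1\,t_2) = ([t/x]^A t_1)\,([t/x]^A t_2)$ if $[t/x]^A t_1$ is neither a $\lambda$- nor a $\Delta$-abstraction, or both $[t/x]^A t_1$ and $t_1$ are ($\lambda$- or $\Delta$-) abstractions; (H4) $[t/x]^A(t_1\,t_2) = [s_2'/y]^{A''} s_1'$ if $[t/x]^A t_1 = \lambda y{:}A''.\,s_1'$, $[t/x]^A t_2 = s_2'$ and $\mathsf{ctype}_A(x,t_1) = A''\to A'$; (H5) $[t/x]^A(t_1\,t_2) = \Delta z{:}\neg A'.\,\langle (y,z,s_2)\rangle^{A''}_{A'} s$ if $[t/x]^A t_1 = \Delta y{:}\neg(A''\to A').\,s$, $[t/x]^A t_2 = s_2$, $\mathsf{ctype}_A(x,t_1) = A''\to A'$, $z$ fresh. In all other situations the value is undefined. -}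

module Defs where

open import Data.Nat using (ℕ; zero; suc; _+_; _≤_; _<_; _<ᵇ_)
open import Data.Bool using (if_then_else_)
open import Data.List using (List; []; _∷_; map)
open import Data.List.Membership.Propositional using (_∈_)
open import Data.Maybe using (Maybe; just; nothing)
open import Data.Product using (_×_; _,_; ∃; ∃₂)
open import Relation.Nullary using (¬_)
open import Data.Sum using (_⊎_)
open import Relation.Binary.PropositionalEquality using (_≡_)

infixr 7 _⇒_
data Ty : Set where
  bot  : Ty
  base : ℕ → Ty
  _⇒_  : Ty → Ty → Ty

neg : Ty → Ty
neg A = A ⇒ bot

-- Terms, with de Bruijn indices (terms are identified up to renaming
-- of bound variables, exactly as in the paper).

data Tm : Set where
  var : ℕ → Tm
  lam : Ty → Tm → Tm
  dlt : Ty → Tm → Tm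
  app : Tm → Tm → Tm

shift : ℕ → ℕ → Tm → Tm
shift d c (var m)     = if m <ᵇ c then var m else var (m + d)
shift d c (lam A t)   = lam A (shift d (suc c) t)
shift d c (dlt A t)   = dlt A (shift d (suc c) t)
shift d c (app t₁ t₂) = app (shift d c t₁) (shift d c t₂)

head : Tm → Tm
head (app t₁ t₂) = head t₁
head t           = t

IsHnf : Tm → Set
IsHnf t = ∃ λ m → head t ≡ var m

IsLam : Tm → Set
IsLam t = ∃₂ λ A u → t ≡ lam A u

IsDelta : Tm → Set
IsDelta t = ∃₂ λ A u → t ≡ dlt A u

IsAbs : Tm → Set
IsAbs t = IsLam t ⊎ IsDelta t

-- Contexts: a context is a list of types, the head being the most
-- recently added (i.e. rightmost) entry, so variable index 0 refers to it.
-- The context  Γ, x:T, Γ'  is  Γ' ++ (T ∷ Γ)  and x is index  length Γ'.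

Ctx : Set
Ctx = List Ty

data _∋_∶_ : Ctx → ℕ → Ty → Set where
  here  : ∀ {Γ A} → (A ∷ Γ) ∋ zero ∶ A
  there : ∀ {Γ A B m} → Γ ∋ m ∶ A → (B ∷ Γ) ∋ suc m ∶ A

infix 4 _⊢_∶_
data _⊢_∶_ (Γ : Ctx) : Tm → Ty → Set where
  Ax    : ∀ {m T} → Γ ∋ m ∶ T → Γ ⊢ var m ∶ T
  Lam   : ∀ {A B t} → (A ∷ Γ) ⊢ t ∶ B → Γ ⊢ lam A t ∶ (A ⇒ B)
  App   : ∀ {A B t₁ t₂} → Γ ⊢ t₁ ∶ (A ⇒ B) → Γ ⊢ t₂ ∶ A → Γ ⊢ app t₁ t₂ ∶ B
  Delta : ∀ {A t} → (neg A ∷ Γ) ⊢ t ∶ bot → Γ ⊢ dlt (neg A) t ∶ A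

-- ctype_T(x, t), with x the variable of index n

ctype : Ty → ℕ → Tm → Maybe Ty
ctype T n (var m) = if m Data.Nat.≡ᵇ n then just T else nothing
ctype T n (app t₁ t₂) with ctype T n t₁
... | just (A ⇒ B) = just B
... | _            = nothing
ctype T n (lam _ _) = nothing
ctype T n (dlt _ _) = nothing

-- Multi-substitutions Θ: lists of triples (y , z , t).
-- y is an index of the input scope, z an index of the output scope,
-- t a term of the output scope.

MSub : Set
MSub = List (ℕ × ℕ × Tm)

shiftΘ : MSub → MSub
shiftΘ = map (λ { (y , z , t) → (suc y , suc z , shift 1 0 t) })

InDom : ℕ → MSub → Set
InDom x Θ = ∃₂ λ z t → (x , z , t) ∈ Θ

-- Hereditary substitution and hereditary structural substitution,
-- given as the graphs of the (partial) functions of the paper.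
--
-- HSub t n A t' r   means   [t/x]^A t' = r,  where x is index n of the
--   scope of t', and t lives in the scope obtained by removing the n
--   innermost binders and x itself (so t is weakened by n when inserted).
-- SSub Θ A₁ A₂ t' r  means   ⟨Θ⟩^{A₁}_{A₂} t' = r.

mutual
  data HSub (t : Tm) : ℕ → Ty → Tm → Tm → Set where
    H1-eq : ∀ {n A} → HSub t n A (var n) (shift n 0 t)
    H1-lt : ∀ {n A m} → m < n → HSub t n A (var m) (var m)
    H1-gt : ∀ {n A k} → n ≤ k → HSub t n A (var (suc k)) (var k)
    H2-lam : ∀ {n A A' t' r} → HSub t (suc n) A t' r →
             HSub t n A (lam A' t') (lam A' r)
    H2-dlt : ∀ {n A A' t' r} → HSub t (suc n) A t' r →
             HSub t n A (dlt A' t') (dlt A' r)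
    H3 : ∀ {n A t₁ t₂ r₁ r₂} →
         HSub t n A t₁ r₁ → HSub t n A t₂ r₂ →
         (¬ IsAbs r₁ ⊎ (IsAbs r₁ × IsAbs t₁)) →
         HSub t n A (app t₁ t₂) (app r₁ r₂)
    H4 : ∀ {n A A' A'' t₁ t₂ s₁ s₂ r} →
         HSub t n A t₁ (lam A'' s₁) → HSub t n A t₂ s₂ →
         ctype A n t₁ ≡ just (A'' ⇒ A') →
         HSub s₂ 0 A'' s₁ r →
         HSub t n A (app t₁ t₂) r
    H5 : ∀ {n A A' A'' t₁ t₂ s s₂ r} →
         HSub t n A t₁ (dlt (neg (A'' ⇒ A')) s) → HSub t n A t₂ s₂ →
         ctype A n t₁ ≡ just (A'' ⇒ A') →
         SSub ((0 , 0 , shift 1 0 s₂) ∷ []) A'' A' s r →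
         HSub t n A (app t₁ t₂) (dlt (neg A') r)

  data SSub (Θ : MSub) (A₁ A₂ : Ty) : Tm → Tm → Set where
    S1 : ∀ {x z t} → (x , z , t) ∈ Θ →
         SSub Θ A₁ A₂ (var x)
           (lam (A₁ ⇒ A₂) (app (var (suc z)) (app (var 0) (shift 1 0 t))))
    S2 : ∀ {x} → ¬ InDom x Θ → SSub Θ A₁ A₂ (var x) (var x)
    S3 : ∀ {A t s} → SSub (shiftΘ Θ) A₁ A₂ t s →
         SSub Θ A₁ A₂ (lam A t) (lam A s)
    S4 : ∀ {A t s} → SSub (shiftΘ Θ) A₁ A₂ t s →
         SSub Θ A₁ A₂ (dlt A t) (dlt A s)
    S5 : ∀ {x z t t'' s r} → (x , z , t) ∈ Θ →
         SSub (shiftΘ Θ) A₁ A₂ t'' s →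
         HSub t 0 A₁ s r →
         SSub Θ A₁ A₂ (app (var x) (lam A₁ t'')) (app (var z) r)
    S6 : ∀ {x z t t'' s} → (x , z , t) ∈ Θ →
         SSub ((0 , 0 , shift 1 0 t) ∷ shiftΘ Θ) A₁ A₂ t'' s →
         SSub Θ A₁ A₂ (app (var x) (dlt (neg (A₁ ⇒ A₂)) t''))
                      (app (var z) (dlt (neg A₂) s))
    S7 : ∀ {x z t t' s'} → (x , z , t) ∈ Θ → ¬ IsAbs t' →
         SSub Θ A₁ A₂ t' s' →
         SSub Θ A₁ A₂ (app (var x) t') (app (var z) s')
    S8 : ∀ {t₁ t₂ s₁ s₂} →
         ¬ (∃ λ x → t₁ ≡ var x × InDom x Θ) →
         SSub Θ A₁ A₂ t₁ s₁ → SSub Θ A₁ A₂ t₂ s₂ →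
         SSub Θ A₁ A₂ (app t₁ t₂) (app s₁ s₂)

module Submission where

-- Both parts of the theorem follow from a single observation about the
-- graph of hereditary substitution: if  [t/x]^T t₁  is an abstraction,
-- then either t₁ is an abstraction with the same binder (clause H2), or
-- the result was produced by one of the clauses H1 (t₁ ≡ x), H4 or H5,
-- and in each of these ctype_T(x, t₁) is defined.  No other clause can
-- return an abstraction.
--
-- Part (i) adds that t₁ is in head normal form; this holds because a
-- defined ctype_T(x, t₁) forces t₁ to be an application spine headed by
-- the variable x ( ctype-defined⇒hnf ).

open import Defs
open import Data.List using (_++_; _∷_; length)
open import Data.Maybe using (just; nothing)
open import Data.Product using (_×_; ∃; _,_)
open import Data.Nat using (ℕ; zero; suc; _≡ᵇ_)
open import Data.Bool using (true)
open import Data.Unit using (⊤)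
open import Data.Empty using (⊥; ⊥-elim)
open import Data.Sum using (_⊎_; inj₁; inj₂)
open import Relation.Nullary using (¬_)
open import Relation.Binary.PropositionalEquality using (_≡_; refl)

CtypeDefined : Ty → ℕ → Tm → Set
CtypeDefined T n t = ∃ λ A → ctype T n t ≡ just A

≡ᵇ-refl : ∀ n → (n ≡ᵇ n) ≡ true
≡ᵇ-refl zero    = refl
≡ᵇ-refl (suc n) = ≡ᵇ-refl n

ctype-var : ∀ T n → ctype T n (var n) ≡ just T
ctype-var T n rewrite ≡ᵇ-refl n = refl

ctype-app : ∀ T n a b {A B} →
            ctype T n a ≡ just (A ⇒ B) → ctype T n (app a b) ≡ just B
ctype-app T n a b eq with ctype T n a
ctype-app T n a b refl | .(just (_ ⇒ _)) = refl

-- A defined ctype forces a variable head: ctype is undefined on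
-- abstractions and only descends into the function part of applications.
ctype-defined⇒hnf : ∀ T n t {A} → ctype T n t ≡ just A → IsHnf t
ctype-defined⇒hnf T n (var m)   _ = m , refl
ctype-defined⇒hnf T n (lam _ _) ()
ctype-defined⇒hnf T n (dlt _ _) ()
ctype-defined⇒hnf T n (app a b) eq with ctype T n a in ea
... | just (_ ⇒ _) = ctype-defined⇒hnf T n a ea
ctype-defined⇒hnf T n (app a b) () | just bot
ctype-defined⇒hnf T n (app a b) () | just (base _)
ctype-defined⇒hnf T n (app a b) () | nothing

var-not-abs : ∀ {m} → ¬ IsAbs (var m)
var-not-abs (inj₁ (_ , _ , ()))
var-not-abs (inj₂ (_ , _ , ()))

app-not-abs : ∀ {a b} → ¬ IsAbs (app a b)
app-not-abs (inj₁ (_ , _ , ()))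
app-not-abs (inj₂ (_ , _ , ()))

SameBinder : Tm → Tm → Set
SameBinder (lam _ _) (lam _ _) = ⊤
SameBinder (dlt _ _) (dlt _ _) = ⊤
SameBinder _         _         = ⊥

abstraction-origin : ∀ {t n T t₁ r} → HSub t n T t₁ r → IsAbs r →
                     SameBinder t₁ r ⊎ CtypeDefined T n t₁
abstraction-origin {n = n} {T = T} H1-eq _ = inj₂ (T , ctype-var T n)
abstraction-origin (H1-lt _)      abs = ⊥-elim (var-not-abs abs)
abstraction-origin (H1-gt _)      abs = ⊥-elim (var-not-abs abs)
abstraction-origin (H2-lam _)     _   = inj₁ _
abstraction-origin (H2-dlt _)     _   = inj₁ _
abstraction-origin (H3 _ _ _)     abs = ⊥-elim (app-not-abs abs)
abstraction-origin {n = n} {T = T} (H4 {A' = A'} {t₁ = a} {t₂ = b} _ _ c _) _ =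
  inj₂ (A' , ctype-app T n a b c)
abstraction-origin {n = n} {T = T} (H5 {A' = A'} {t₁ = a} {t₂ = b} _ _ c _) _ =
  inj₂ (A' , ctype-app T n a b c)

sameBinder-lam : ∀ {t₁ A u} → SameBinder t₁ (lam A u) → IsLam t₁
sameBinder-lam {lam _ _} _ = _ , _ , refl

sameBinder-dlt : ∀ {t₁ A u} → SameBinder t₁ (dlt A u) → IsDelta t₁
sameBinder-dlt {dlt _ _} _ = _ , _ , refl

lam-result : ∀ {t n T t₁ A u} → HSub t n T t₁ (lam A u) → ¬ IsLam t₁ →
             IsHnf t₁ × CtypeDefined T n t₁
lam-result {n = n} {T = T} {t₁ = t₁} h notLam
  with abstraction-origin h (inj₁ (_ , _ , refl))
... | inj₁ same            = ⊥-elim (notLam (sameBinder-lam same))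
... | inj₂ (A , ctype≡A)   = ctype-defined⇒hnf T n t₁ ctype≡A , (A , ctype≡A)

dlt-result : ∀ {t n T t₁ A u} → HSub t n T t₁ (dlt A u) → ¬ IsDelta t₁ →
             CtypeDefined T n t₁
dlt-result h notDelta with abstraction-origin h (inj₂ (_ , _ , refl))
... | inj₁ same    = ⊥-elim (notDelta (sameBinder-dlt same))
... | inj₂ defined = defined

mainTheorem7 :
    (∀ (Γ Γ' : Ctx) (T T' T₁ : Ty) (t t₁ t₂ t' : Tm) →
      (Γ' ++ T ∷ Γ) ⊢ app t₁ t₂ ∶ T' →
      Γ ⊢ t ∶ T →
      HSub t (length Γ') T t₁ (lam T₁ t') →
      ¬ IsLam t₁ →
      IsHnf t₁ × ∃ λ A → ctype T (length Γ') t₁ ≡ just A)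
    ×
    (∀ (Γ Γ' : Ctx) (T T' T'' : Ty) (t t₁ t₂ t' : Tm) →
      (Γ' ++ T ∷ Γ) ⊢ app t₁ t₂ ∶ T' →
      Γ ⊢ t ∶ T →
      HSub t (length Γ') T t₁ (dlt (neg (T'' ⇒ T')) t') →
      ¬ IsDelta t₁ →
      ∃ λ A → ctype T (length Γ') t₁ ≡ just A)
mainTheorem7 =
    (λ _ _ _ _ _ _ _ _ _ _ _ subst notLam → lam-result subst notLam)
  , (λ _ _ _ _ _ _ _ _ _ _ _ subst notDelta → dlt-result subst notDelta)
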